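{- Let $\alpha:X_n\to X_n$ be a full contraction of $X_n=\{1,\dots,n\}$ with $f(\alpha)=m$. Then $F(\alpha)=\{i,i+1,\dots,i+m-1\}$ for some $i$; equivalently, $F(\alpha)$ is convex (an interval of consecutive integers).
   Context: A contraction is a map $\alpha:X_n\to X_n$ (written $x\mapsto x\alpha$) with $|x\alpha-y\alpha|\le|x-y|$ for all $x,y\in X_n$. $F(\alpha)=\{x\in X_n: x\alpha=x\}$ and $f(\alpha)=|F(\alpha)|$. -}

module Defs where

open import Data.Nat using (ℕ; suc; ∣_-_∣; _≤_)
open import Data.Fin using (Fin; toℕ; _≟_)
open import Data.List using (length; filter; allFin)
open import Relation.Binary.PropositionalEquality using (_≡_)

-- X_n = {1,…,n} is modelled by Fin n; the element k : Fin n stands for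
-- the integer toℕ k + 1 (so |x - y| = ∣ toℕ x - toℕ y ∣).
X : ℕ → Set
X n = Fin n

dist : ∀ {n} → X n → X n → ℕ
dist x y = ∣ toℕ x - toℕ y ∣

IsContraction : ∀ {n} → (X n → X n) → Set
IsContraction {n} α = ∀ (x y : X n) → dist (α x) (α y) ≤ dist x y

_∈F_ : ∀ {n} → X n → (X n → X n) → Set
x ∈F α = α x ≡ x

f : ∀ {n} → (X n → X n) → ℕ
f {n} α = length (filter (λ x → α x ≟ x) (allFin n))

module Submission where

-- If a ≤ c ≤ b with a and b fixed, then cα is no further from a
-- than c is and no further from b than c is; the first forces cα ≤ c and
-- the second c ≤ cα, so c is fixed: F(α) is convex.  Conversely every
-- decidable convex subset of X_n is an interval whose length is its
-- cardinality.

open import Defs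
open import Data.Nat using (ℕ; zero; suc; _+_; _≤_; _<_; z≤n; s≤s; ∣_-_∣)
open import Data.Nat.Properties
  using (≤-refl; ≤-trans; ≤-antisym; <-irrefl; m∸n≤m; m≤n⇒∣m-n∣≡n∸m; m<m+n; m+n≤o⇒n≤o; +-identityʳ)
open import Data.Fin using (Fin; zero; suc; toℕ; fromℕ<; _≟_)
open import Data.Fin.Properties using (toℕ-injective; toℕ-fromℕ<)
open import Data.Product using (∃-syntax; _×_; _,_)
open import Data.List using (length; filter; tabulate)
open import Data.Empty using (⊥-elim)
open import Function using (_∘_)
open import Function.Bundles using (_⇔_; mk⇔; Equivalence)
open import Relation.Nullary using (yes; no; ¬_)
open import Relation.Unary using (Decidable)
open import Relation.Binary.PropositionalEquality using (_≡_; refl; sym; trans; cong; subst)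

open Equivalence using (to; from)

closer-stays-below : ∀ x y z → ∣ x - z ∣ ≤ ∣ y - z ∣ → z ≤ y → x ≤ y
closer-stays-below zero    y       z       _ _         = z≤n
closer-stays-below (suc x) zero    zero    h _         = h
closer-stays-below (suc x) (suc y) zero    h _         = h
closer-stays-below (suc x) (suc y) (suc z) h (s≤s z≤y) = s≤s (closer-stays-below x y z h z≤y)

closer-stays-above : ∀ x y z → ∣ x - z ∣ ≤ ∣ y - z ∣ → y ≤ z → y ≤ x
closer-stays-above x       zero    z       _ _         = z≤n
closer-stays-above zero    (suc y) (suc z) h (s≤s y≤z) =
  -- here h says  suc z ≤ ∣ y - z ∣ = z ∸ y ≤ z
  ⊥-elim (<-irrefl refl (≤-trans h (subst (_≤ z) (sym (m≤n⇒∣m-n∣≡n∸m y≤z)) (m∸n≤m z y))))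
closer-stays-above (suc x) (suc y) (suc z) h (s≤s y≤z) = s≤s (closer-stays-above x y z h y≤z)

Convex : ∀ {n} → (Fin n → Set) → Set
Convex {n} P = ∀ (a b c : Fin n) → P a → P b → toℕ a ≤ toℕ c → toℕ c ≤ toℕ b → P c

fixedPoints-convex : ∀ {n} (α : X n → X n) → IsContraction α → Convex (_∈F α)
fixedPoints-convex α contr a b c αa≡a αb≡b a≤c c≤b =
  toℕ-injective (≤-antisym (closer-stays-below _ _ _ near-a a≤c)
                           (closer-stays-above _ _ _ near-b c≤b))
  where
  near-a : dist (α c) a ≤ dist c a
  near-a = subst (λ w → dist (α c) w ≤ dist c a) αa≡a (contr c a)
  near-b : dist (α c) b ≤ dist c b
  near-b = subst (λ w → dist (α c) w ≤ dist c b) αb≡b (contr c b)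

convex-tail : ∀ {n} {P : Fin (suc n) → Set} → Convex P → Convex (P ∘ suc)
convex-tail cv a b c pa pb a≤c c≤b = cv (suc a) (suc b) (suc c) pa pb (s≤s a≤c) (s≤s c≤b)

count : ∀ {n} {P : (Fin n → Set)} → Decidable P → ℕ
count {zero}  d = 0
count {suc n} d with d zero
... | yes _ = suc (count (d ∘ suc))
... | no  _ = count (d ∘ suc)

count-filter-tabulate : ∀ {A : Set} {n} {P : A → Set} (d : Decidable P) (g : Fin n → A)
  → length (filter d (tabulate g)) ≡ count (d ∘ g)
count-filter-tabulate {n = zero}  d g = refl
count-filter-tabulate {n = suc n} d g with d (g zero)
... | yes _ = cong suc (count-filter-tabulate d (g ∘ suc))
... | no  _ = count-filter-tabulate d (g ∘ suc)

f-count : ∀ {n} (α : X n → X n) → f α ≡ count (λ x → α x ≟ x)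
f-count α = count-filter-tabulate (λ x → α x ≟ x) (λ x → x)

IsInterval : ∀ {n} → (Fin n → Set) → ℕ → ℕ → Set
IsInterval P j c = ∀ x → P x ⇔ (j ≤ toℕ x × toℕ x < j + c)

interval-cons-no : ∀ {n} {P : Fin (suc n) → Set} {j c}
  → ¬ P zero → IsInterval (P ∘ suc) j c → IsInterval P (suc j) c
interval-cons-no ¬p0 iv zero    = mk⇔ (⊥-elim ∘ ¬p0) (λ { (() , _) })
interval-cons-no ¬p0 iv (suc y) = mk⇔
  (λ p → let (j≤y , y<j+c) = to (iv y) p in s≤s j≤y , s≤s y<j+c)
  (λ { (s≤s j≤y , s≤s y<j+c) → from (iv y) (j≤y , y<j+c) })

interval-cons-yes : ∀ {n} {P : Fin (suc n) → Set} {c}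
  → P zero → IsInterval (P ∘ suc) 0 c → IsInterval P 0 (suc c)
interval-cons-yes p0 iv zero    = mk⇔ (λ _ → z≤n , s≤s z≤n) (λ _ → p0)
interval-cons-yes p0 iv (suc y) = mk⇔
  (λ p → let (_ , y<c) = to (iv y) p in z≤n , s≤s y<c)
  (λ { (_ , s≤s y<c) → from (iv y) (z≤n , y<c) })

interval-empty : ∀ {n} {Q : Fin n → Set} {j} → IsInterval Q j 0 → IsInterval Q 0 0
interval-empty {j = j} iv y = mk⇔ (λ q → ⊥-elim (empty (to (iv y) q))) (λ { (_ , ()) })
  where
  empty : ¬ (j ≤ toℕ y × toℕ y < j + 0)
  empty (j≤y , y<j+0) = <-irrefl refl (≤-trans (subst (toℕ y <_) (+-identityʳ j) y<j+0) j≤y)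

-- If 0 ∈ P with P convex, a nonempty interval of P ∘ suc cannot start
-- above 0: the element 1 would lie between 0 and its start.
tail-interval-not-above-zero : ∀ {n} {P : Fin (suc n) → Set} {k c} → Convex P → P zero
  → suc k + suc c ≤ n → ¬ IsInterval (P ∘ suc) (suc k) (suc c)
tail-interval-not-above-zero {zero}  cv p0 () iv
tail-interval-not-above-zero {suc n} {P} {k} {c} cv p0 fit iv = one-outside (to (iv zero) p1)
  where
  start<n : suc k < suc n
  start<n = ≤-trans (m<m+n (suc k) (s≤s z≤n)) fit
  start : Fin (suc n)
  start = fromℕ< start<n
  p-start : P (suc start)
  p-start = from (iv start) (subst (λ t → suc k ≤ t × t < suc k + suc c) (sym (toℕ-fromℕ< start<n))
                               (≤-refl , m<m+n (suc k) (s≤s z≤n)))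
  p1 : P (suc zero)
  p1 = cv zero (suc start) (suc zero) p0 p-start z≤n (s≤s z≤n)
  one-outside : ¬ (suc k ≤ 0 × 0 < suc k + suc c)
  one-outside (() , _)

tail-interval-at-zero : ∀ {n} {P : Fin (suc n) → Set} {j c} → Convex P → P zero
  → j + c ≤ n → IsInterval (P ∘ suc) j c → IsInterval (P ∘ suc) 0 c
tail-interval-at-zero {c = zero}              cv p0 fit iv = interval-empty iv
tail-interval-at-zero {j = zero}  {c = suc c} cv p0 fit iv = iv
tail-interval-at-zero {j = suc k} {c = suc c} cv p0 fit iv =
  ⊥-elim (tail-interval-not-above-zero cv p0 fit iv)

convex-interval : ∀ {n} {P : Fin n → Set} (d : Decidable P) → Convex P
  → ∃[ j ] (j + count d ≤ n × IsInterval P j (count d))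
convex-interval {zero}  d cv = 0 , z≤n , λ ()
convex-interval {suc n} d cv with convex-interval (d ∘ suc) (convex-tail cv) | d zero
... | j , fit , iv | no ¬p0 = suc j , s≤s fit , interval-cons-no ¬p0 iv
... | j , fit , iv | yes p0 =
  0 , s≤s (m+n≤o⇒n≤o j fit) , interval-cons-yes p0 (tail-interval-at-zero cv p0 fit iv)

interval-one-based : ∀ {n} {P : Fin n → Set} {j c} → IsInterval P j c
  → ∀ x → P x ⇔ (suc j ≤ suc (toℕ x) × suc (toℕ x) < suc j + c)
interval-one-based iv x = mk⇔
  (λ p → let (j≤x , x<j+c) = to (iv x) p in s≤s j≤x , s≤s x<j+c)
  (λ { (s≤s j≤x , s≤s x<j+c) → from (iv x) (j≤x , x<j+c) })

lemma1p1 : ∀ (n : ℕ) (α : X n → X n) (m : ℕ) → IsContraction α → f α ≡ m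
    → ∃[ i ] (∀ (x : X n) → (x ∈F α) ⇔ (i ≤ suc (toℕ x) × suc (toℕ x) < i + m))
lemma1p1 n α m contr fα≡m
  with convex-interval (λ x → α x ≟ x) (fixedPoints-convex α contr)
... | j , _ , iv = suc j , interval-one-based fixedPoints-interval
  where
  fixedPoints-interval : IsInterval (_∈F α) j m
  fixedPoints-interval = subst (IsInterval (_∈F α) j) (trans (sym (f-count α)) fα≡m) iv
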